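{- In a flow network, an outcome $A\subseteq X$ is path-or-cycle-stable if and only if it is stable.
   Context: A trading network consists of a finite set $F$ of agents and a finite set $X$ of contracts. Each contract $x\in X$ has a seller $s(x)\in F$ and a buyer $b(x)\in F$ with $s(x)\neq b(x)$. For $f\in F$ and $Y\subseteq X$, let $Y^B_f=\{y\in Y: b(y)=f\}$, $Y^S_f=\{y\in Y: s(y)=f\}$, $Y_f=Y^B_f\cup Y^S_f$. Each agent $f$ has a choice function $C^f$ with $C^f(Y_f)\subseteq Y_f$; write $C^f(Y)$ for $C^f(Y_f)$. An agent is terminal if $X^B_f=\emptyset$ or $X^S_f=\emptyset$. A choice function $C^f$ is flow-based if: when $f$ is terminal, $C^f(Y_f)=Y_f$ for all $Y$; when $f$ is non-terminal, $f$ has linear orders $\succ^B_f$ on $X^B_f$ and $\succ^S_f$ on $X^S_f$, and given upstream contracts $Y\subseteq X^B_f$ and downstream contracts $Z\subseteq X^S_f$, $f$ chooses its $k$ most preferred contracts of $Y$ under $\succ^B_f$ and its $k$ most preferred of $Z$ under $\succ^S_f$, with $k=\min\{|Y|,|Z|\}$. A flow network is a trading network with exactly two terminal agents in which all choice functions are flow-based. An outcome is any $A\subseteq X$; it is acceptable if $C^f(A_f)=A_f$ for all $f$. For $B,A\subseteq X$, $B$ is $(A,f)$-acceptable if $B_f\subseteq C^f(A_f\cup B_f)$. Let $F(B)=\{s(x),b(x):x\in B\}$. A non-empty $P\subseteq X$ is a path if its elements can be ordered $(x_1,\dots,x_M)$ with $b(x_m)=s(x_{m+1})$ for $1\le m<M$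 and $s(x_1),\dots,s(x_M),b(x_M)$ all distinct. A non-empty $C\subseteq X$ is a cycle if its elements can be ordered $(x_1,\dots,x_M)$ with $b(x_m)=s(x_{m+1})$ for $1\le m<M$, $s(x_1),\dots,s(x_M)$ distinct, and $b(x_M)=s(x_1)$. $A$ is path-or-cycle-stable if $A$ is acceptable and there is no path or cycle $B$ with $B\cap A=\emptyset$ that is $(A,f)$-acceptable for all $f\in F(B)$. $A$ is stable if $A$ is acceptable and there is no non-empty $Z\subseteq X$ with $Z\cap A=\emptyset$ that is $(A,f)$-acceptable for all $f\in F(Z)$. -}

module Defs where

open import Data.Nat using (ℕ; zero; suc; _+_; _<_; _<ᵇ_; _⊓_)
open import Data.Fin using (Fin; _≟_) renaming (zero to fzero; suc to fsuc)
open import Data.Bool using (Bool; true; false; if_then_else_; _∧_; _∨_)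
open import Data.List using (List; []; _∷_; map; _++_; [_])
open import Data.List.Relation.Unary.Unique.Propositional using (Unique)
open import Data.List.Membership.Propositional using (_∈_)
open import Data.Product using (Σ; ∃; _×_; _,_)
open import Data.Sum using (_⊎_)
open import Data.Empty using (⊥)
open import Data.Unit using (⊤)
open import Relation.Nullary using (¬_)
open import Relation.Nullary.Decidable using (⌊_⌋)
open import Relation.Binary.PropositionalEquality using (_≡_; _≢_)
open import Function using (_∘_; _⇔_)

count : ∀ {m} → (Fin m → Bool) → ℕ
count {zero}  p = 0
count {suc m} p = (if p fzero then 1 else 0) + count (p ∘ fsuc)

-- Outcomes / sets of contracts: subsets of X = Fin m.
Outcome : ℕ → Set
Outcome m = Fin m → Bool

_∪_ : ∀ {m} → Outcome m → Outcome m → Outcome m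
(A ∪ B) x = A x ∨ B x

-- A trading network with agents F = Fin n and contracts X = Fin m,
-- equipped with the data of flow-based choice functions: for each agent f,
-- a linear order on X^B_f and on X^S_f, encoded as ranks (smaller rank =
-- more preferred) that are injective on X^B_f resp. X^S_f.
record FlowNetwork (n m : ℕ) : Set where
  field
    seller buyer : Fin m → Fin n
    seller≢buyer : ∀ x → seller x ≢ buyer x
    rankB rankS  : Fin n → Fin m → ℕ
    rankB-inj : ∀ f x y → buyer x ≡ f → buyer y ≡ f → rankB f x ≡ rankB f y → x ≡ y
    rankS-inj : ∀ f x y → seller x ≡ f → seller y ≡ f → rankS f x ≡ rankS f y → x ≡ y

  Terminal : Fin n → Set
  Terminal f = (∀ x → buyer x ≢ f) ⊎ (∀ x → seller x ≢ f)

  field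
    twoTerminals : Σ (Fin n) λ t₁ → Σ (Fin n) λ t₂ → t₁ ≢ t₂ × Terminal t₁ × Terminal t₂ ×
                     (∀ f → Terminal f → f ≡ t₁ ⊎ f ≡ t₂)

  InF : Fin n → Outcome m → Fin m → Set
  InF f Y x = Y x ≡ true × (seller x ≡ f ⊎ buyer x ≡ f)

  YB YS : Fin n → Outcome m → Outcome m
  YB f Y y = Y y ∧ ⌊ buyer y ≟ f ⌋
  YS f Y y = Y y ∧ ⌊ seller y ≟ f ⌋

  kf : Fin n → Outcome m → ℕ
  kf f Y = count (YB f Y) ⊓ count (YS f Y)

  -- x is among the k most preferred of Y^B_f (if x is upstream) or of Y^S_f
  -- (if x is downstream): fewer than k contracts of that side are preferred to x.
  TopK : Fin n → Outcome m → Fin m → Set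
  TopK f Y x =
      (buyer x ≡ f → count (λ y → YB f Y y ∧ (rankB f y <ᵇ rankB f x)) < kf f Y)
    × (seller x ≡ f → count (λ y → YS f Y y ∧ (rankS f y <ᵇ rankS f x)) < kf f Y)

  -- x ∈ C^f(Y_f): terminal agents choose everything, non-terminal agents
  -- choose flow-based.
  InC : Fin n → Outcome m → Fin m → Set
  InC f Y x = InF f Y x × (Terminal f ⊎ (¬ Terminal f × TopK f Y x))

  Acceptable : Outcome m → Set
  Acceptable A = ∀ f x → (InC f A x → InF f A x) × (InF f A x → InC f A x)

  AfAcceptable : Outcome m → Fin n → Outcome m → Set
  AfAcceptable A f B = ∀ x → InF f B x → InC f (A ∪ B) x

  InAgents : Outcome m → Fin n → Set
  InAgents B f = ∃ λ x → InF f B x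

  Disjoint : Outcome m → Outcome m → Set
  Disjoint A B = ∀ x → A x ≡ true → B x ≡ true → ⊥

  Blocks : Outcome m → Outcome m → Set
  Blocks A B = Disjoint B A × (∀ f → InAgents B f → AfAcceptable A f B)

  Linked : List (Fin m) → Set
  Linked []           = ⊤
  Linked (x ∷ [])     = ⊤
  Linked (x ∷ y ∷ xs) = buyer x ≡ seller y × Linked (y ∷ xs)

  last : Fin m → List (Fin m) → Fin m
  last x []       = x
  last x (y ∷ ys) = last y ys

  Enumerates : Outcome m → List (Fin m) → Set
  Enumerates B xs = ∀ x → (B x ≡ true → x ∈ xs) × (x ∈ xs → B x ≡ true)

  IsPath : Outcome m → Set
  IsPath B = Σ (Fin m) λ x₁ → Σ (List (Fin m)) λ xs →
    Enumerates B (x₁ ∷ xs) × Linked (x₁ ∷ xs) ×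
    Unique (map seller (x₁ ∷ xs) ++ [ buyer (last x₁ xs) ])

  IsCycle : Outcome m → Set
  IsCycle B = Σ (Fin m) λ x₁ → Σ (List (Fin m)) λ xs →
    Enumerates B (x₁ ∷ xs) × Linked (x₁ ∷ xs) ×
    Unique (map seller (x₁ ∷ xs)) × buyer (last x₁ xs) ≡ seller x₁

  PathOrCycleStable : Outcome m → Set
  PathOrCycleStable A = Acceptable A ×
    (∀ B → (IsPath B ⊎ IsCycle B) → ¬ Blocks A B)

  Stable : Outcome m → Set
  Stable A = Acceptable A ×
    (∀ Z → (∃ λ x → Z x ≡ true) → ¬ Blocks A Z)

module Submission where

-- Paths and cycles are non-empty, so a stable outcome is path-or-cycle-stable.  For the
-- converse we show that every non-empty set Z blocking an acceptable outcome A contains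
-- a path or cycle that blocks A.

open import Data.Nat using (ℕ; zero; suc; _+_; _<_; _≤_; _<ᵇ_; z≤n; s≤s)
open import Data.Nat.Properties
  using (≤-refl; ≤-trans; ≤-reflexive; <-≤-trans; <⇒≱; <⇒≤; ≰⇒>; _≤?_; n≤1+n;
         +-mono-≤; +-mono-≤-<; +-suc; +-identityʳ; m≤n+m; m≤n⇒m<n∨m≡n;
         m⊓n≤m; m⊓n≤n; ⊓-glb; <⇒<ᵇ; module ≤-Reasoning)
open import Data.Fin using (Fin; _≟_) renaming (zero to fzero; suc to fsuc)
open import Data.Fin.Properties using (all?; any?)
open import Data.Bool using (Bool; true; false; if_then_else_; _∧_; _∨_)
import Data.Bool as Bool
open import Data.Bool.Properties using (T-≡; ∧-zeroʳ)
open import Data.List using (List; []; _∷_; _++_; [_]; _∷ʳ_; map; length; reverse)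
open import Data.List.Properties using (unfold-reverse)
open import Data.List.Relation.Unary.All using (All; []; _∷_)
import Data.List.Relation.Unary.All as All
import Data.List.Relation.Unary.All.Properties as All
open import Data.List.Relation.Unary.AllPairs using ([]; _∷_)
open import Data.List.Relation.Unary.Any using (here; there)
open import Data.List.Relation.Unary.Unique.Propositional using (Unique)
open import Data.List.Membership.Propositional using (_∈_)
open import Data.List.Relation.Binary.Permutation.Propositional using (_↭_; ↭-sym; ↭⇒↭ₛ)
open import Data.List.Relation.Binary.Permutation.Propositional.Properties
  using (shift; ∷↭∷ʳ; ↭-reverse; All-resp-↭; map⁺)
open import Data.List.Relation.Binary.Permutation.Setoid.Properties using (Unique-resp-↭)
open import Data.Product using (Σ; ∃; _×_; _,_; proj₁; proj₂)
open import Data.Sum using (_⊎_; inj₁; inj₂)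
open import Data.Empty using (⊥-elim)
open import Data.Unit using (⊤; tt)
open import Relation.Nullary using (Dec; yes; no; ¬_)
open import Relation.Nullary.Decidable using (⌊_⌋; ¬?; _⊎-dec_; _×-dec_)
open import Relation.Binary.PropositionalEquality
  using (_≡_; _≢_; refl; sym; trans; cong; cong₂; subst; setoid)
open import Function using (_∘_; _⇔_; mk⇔; Equivalence)
open import Defs

true≢false : true ≢ false
true≢false ()

∧-elim : ∀ {a b} → a ∧ b ≡ true → a ≡ true × b ≡ true
∧-elim {true} {true} _ = refl , refl

∧-intro : ∀ {a b} → a ≡ true → b ≡ true → a ∧ b ≡ true
∧-intro refl refl = refl

∨-elim : ∀ {a b} → a ∨ b ≡ true → a ≡ true ⊎ b ≡ true
∨-elim {true}  _ = inj₁ refl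
∨-elim {false} e = inj₂ e

∨-introˡ : ∀ {a b} → a ≡ true → a ∨ b ≡ true
∨-introˡ refl = refl

∨-introʳ : ∀ {a b} → b ≡ true → a ∨ b ≡ true
∨-introʳ {true}  _ = refl
∨-introʳ {false} e = e

isYes-intro : ∀ {p} {P : Set p} (d : Dec P) → P → ⌊ d ⌋ ≡ true
isYes-intro (yes _) _ = refl
isYes-intro (no ¬p) p = ⊥-elim (¬p p)

isYes-elim : ∀ {p} {P : Set p} (d : Dec P) → ⌊ d ⌋ ≡ true → P
isYes-elim (yes p) _ = p

¬-isYes : ∀ {p} {P : Set p} (d : Dec P) → ¬ P → ⌊ d ⌋ ≡ false
¬-isYes (yes p) ¬p = ⊥-elim (¬p p)
¬-isYes (no _)  _  = refl

<ᵇ-intro : ∀ {a b} → a < b → (a <ᵇ b) ≡ true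
<ᵇ-intro a<b = Equivalence.to T-≡ (<⇒<ᵇ a<b)

<ᵇ-irrefl : ∀ a → (a <ᵇ a) ≡ false
<ᵇ-irrefl zero    = refl
<ᵇ-irrefl (suc a) = <ᵇ-irrefl a

_⊆_ : ∀ {m} → (Fin m → Bool) → (Fin m → Bool) → Set
p ⊆ q = ∀ x → p x ≡ true → q x ≡ true

indicator-mono : ∀ {a b : Bool} → (a ≡ true → b ≡ true) →
  (if a then 1 else 0) ≤ (if b then 1 else 0)
indicator-mono {false} _ = z≤n
indicator-mono {true}  h rewrite h refl = ≤-refl

indicator≤1 : ∀ a → (if a then 1 else 0) ≤ 1
indicator≤1 true  = ≤-refl
indicator≤1 false = z≤n

count-mono : ∀ {m} (p q : Fin m → Bool) → p ⊆ q → count p ≤ count q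
count-mono {zero}  p q p⊆q = z≤n
count-mono {suc m} p q p⊆q =
  +-mono-≤ (indicator-mono (p⊆q fzero)) (count-mono (p ∘ fsuc) (q ∘ fsuc) (p⊆q ∘ fsuc))

count-strict : ∀ {m} (p q : Fin m → Bool) → p ⊆ q →
  ∀ w → q w ≡ true → p w ≡ false → count p < count q
count-strict {suc m} p q p⊆q fzero qw pw rewrite qw | pw =
  s≤s (count-mono (p ∘ fsuc) (q ∘ fsuc) (p⊆q ∘ fsuc))
count-strict {suc m} p q p⊆q (fsuc w) qw pw =
  +-mono-≤-< (indicator-mono (p⊆q fzero))
             (count-strict (p ∘ fsuc) (q ∘ fsuc) (p⊆q ∘ fsuc) w qw pw)

count≤size : ∀ {m} (p : Fin m → Bool) → count p ≤ m
count≤size {zero}  p = z≤n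
count≤size {suc m} p = +-mono-≤ (indicator≤1 (p fzero)) (count≤size (p ∘ fsuc))

count-insert : ∀ {m} (p q : Fin m → Bool) (u : Fin m) →
  (∀ y → p y ≡ true → q y ≡ true ⊎ y ≡ u) → count p ≤ suc (count q)
count-insert {suc m} p q fzero p⊆q+u =
  +-mono-≤ (indicator≤1 (p fzero))
    (≤-trans (count-mono (p ∘ fsuc) (q ∘ fsuc) tail⊆) (m≤n+m _ (if q fzero then 1 else 0)))
  where
  tail⊆ : (p ∘ fsuc) ⊆ (q ∘ fsuc)
  tail⊆ y py with p⊆q+u (fsuc y) py
  ... | inj₁ qy = qy
count-insert {suc m} p q (fsuc u) p⊆q+u =
  ≤-trans (+-mono-≤ (indicator-mono head⊆) (count-insert (p ∘ fsuc) (q ∘ fsuc) u tail⊆))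
          (≤-reflexive (+-suc _ _))
  where
  head⊆ : p fzero ≡ true → q fzero ≡ true
  head⊆ p0 with p⊆q+u fzero p0
  ... | inj₁ q0 = q0
  tail⊆ : ∀ y → p (fsuc y) ≡ true → q (fsuc y) ≡ true ⊎ y ≡ u
  tail⊆ y py with p⊆q+u (fsuc y) py
  ... | inj₁ qy   = inj₁ qy
  ... | inj₂ refl = inj₂ refl

count-empty : ∀ {m} (p : Fin m → Bool) → (∀ w → p w ≡ false) → count p ≡ 0
count-empty {zero}  p empty = refl
count-empty {suc m} p empty rewrite empty fzero = count-empty (p ∘ fsuc) (empty ∘ fsuc)

empty-or-maximum : ∀ {m} (p : Fin m → Bool) (r : Fin m → ℕ) →
  (∀ w → p w ≡ false) ⊎ Σ (Fin m) λ u → p u ≡ true × (∀ y → p y ≡ true → r y ≤ r u)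
empty-or-maximum {zero}  p r = inj₁ λ ()
empty-or-maximum {suc m} p r with empty-or-maximum (p ∘ fsuc) (r ∘ fsuc) | p fzero in p0
... | inj₁ empty | false = inj₁ λ { fzero → p0 ; (fsuc w) → empty w }
... | inj₁ empty | true  = inj₂ (fzero , p0 , λ
  { fzero    _  → ≤-refl
  ; (fsuc y) py → ⊥-elim (true≢false (trans (sym py) (empty y))) })
... | inj₂ (u , pu , max) | false = inj₂ (fsuc u , pu , λ
  { fzero    py → ⊥-elim (true≢false (trans (sym py) p0))
  ; (fsuc y) py → max y py })
... | inj₂ (u , pu , max) | true with r fzero ≤? r (fsuc u)
...   | yes r0≤ = inj₂ (fsuc u , pu , λ { fzero _ → r0≤ ; (fsuc y) py → max y py })
...   | no  r0≰ = inj₂ (fzero , p0 , λ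
  { fzero    _  → ≤-refl
  ; (fsuc y) py → ≤-trans (max y py) (<⇒≤ (≰⇒> r0≰)) })

-- The rank argument behind the balance of acceptable outcomes: if r is injective on Q
-- and every element of Q has fewer than K elements of Q ranked below it, then |Q| ≤ K.
count-≤-by-rank : ∀ {m} (Q : Fin m → Bool) (r : Fin m → ℕ) (K : ℕ) →
  (∀ a b → Q a ≡ true → Q b ≡ true → r a ≡ r b → a ≡ b) →
  (∀ a → Q a ≡ true → count (λ y → Q y ∧ (r y <ᵇ r a)) < K) →
  count Q ≤ K
count-≤-by-rank Q r K r-inj below with empty-or-maximum Q r
... | inj₁ empty = ≤-trans (≤-reflexive (count-empty Q empty)) z≤n
... | inj₂ (u , Qu , max) = ≤-trans (count-insert Q _ u ranked-below-u) (below u Qu)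
  where
  ranked-below-u : ∀ y → Q y ≡ true → (Q y ∧ (r y <ᵇ r u)) ≡ true ⊎ y ≡ u
  ranked-below-u y Qy with m≤n⇒m<n∨m≡n (max y Qy)
  ... | inj₁ ry<ru = inj₁ (∧-intro Qy (<ᵇ-intro ry<ru))
  ... | inj₂ ry≡ru = inj₂ (r-inj y u Qy Qu ry≡ru)

unique-prefix : ∀ {a} {X : Set a} (xs : List X) {ys : List X} → Unique (xs ++ ys) → Unique xs
unique-prefix []       _              = []
unique-prefix (x ∷ xs) (x∉ ∷ unique) = All.++⁻ˡ xs x∉ ∷ unique-prefix xs unique

unique-shift : ∀ {a} {X : Set a} (xs : List X) {v ys} → Unique (xs ++ v ∷ ys) → Unique (v ∷ xs)
unique-shift xs {v} {ys} unique =
  unique-prefix (v ∷ xs) (Unique-resp-↭ (setoid _) (↭⇒↭ₛ (shift v xs ys)) unique)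

unique-permute : ∀ {a} {X : Set a} {xs ys : List X} → xs ↭ ys → Unique xs → Unique ys
unique-permute xs↭ys = Unique-resp-↭ (setoid _) (↭⇒↭ₛ xs↭ys)

unique-map-injective : ∀ {a b} {X : Set a} {Y : Set b} (f : X → Y) {xs : List X} →
  Unique (map f xs) → ∀ {x y} → x ∈ xs → y ∈ xs → f x ≡ f y → x ≡ y
unique-map-injective f _            (here refl) (here refl) _     = refl
unique-map-injective f (fx∉ ∷ _)    (here refl) (there y∈)  fx≡fy =
  ⊥-elim (All.lookup (All.map⁻ fx∉) y∈ fx≡fy)
unique-map-injective f (fy∉ ∷ _)    (there x∈)  (here refl) fx≡fy =
  ⊥-elim (All.lookup (All.map⁻ fy∉) x∈ (sym fx≡fy))
unique-map-injective f (_ ∷ unique) (there x∈)  (there y∈)  fx≡fy =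
  unique-map-injective f unique x∈ y∈ fx≡fy

unique-length≤ : ∀ {n} (vs : List (Fin n)) → Unique vs → length vs ≤ n
unique-length≤ {n} vs unique = ≤-trans (length≤count vs unique) (count≤size _)
  where
  open import Data.List.Membership.DecPropositional (_≟_ {n}) using (_∈?_)
  length≤count : ∀ vs → Unique vs → length vs ≤ count (λ v → ⌊ v ∈? vs ⌋)
  length≤count []       _              = z≤n
  length≤count (v ∷ ws) (v∉ws ∷ unique) =
    ≤-trans (s≤s (length≤count ws unique))
      (count-strict _ _ grows v (isYes-intro (v ∈? v ∷ ws) (here refl))
        (¬-isYes (v ∈? ws) (λ v∈ws → All.lookup v∉ws v∈ws refl)))
    where
    grows : (λ w → ⌊ w ∈? ws ⌋) ⊆ (λ w → ⌊ w ∈? v ∷ ws ⌋)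
    grows w w∈ws = isYes-intro (w ∈? v ∷ ws) (there (isYes-elim (w ∈? ws) w∈ws))

-- The sets YB, YS and the counts in TopK are instances.

Side : ∀ {n m} → (Fin m → Fin n) → Fin n → Outcome m → Outcome m
Side e f Y y = Y y ∧ ⌊ e y ≟ f ⌋

Pref : ∀ {n m} → (Fin m → Fin n) → (Fin m → ℕ) → Fin n → Outcome m → Fin m → Outcome m
Pref e r f Y x y = Side e f Y y ∧ (r y <ᵇ r x)

module _ {n m : ℕ} (e : Fin m → Fin n) (f : Fin n) where

  side-elim : ∀ Y {y} → Side e f Y y ≡ true → Y y ≡ true × e y ≡ f
  side-elim Y {y} s with ∧-elim {Y y} s
  ... | Yy , ey = Yy , isYes-elim (e y ≟ f) ey

  side-intro : ∀ Y {y} → Y y ≡ true → e y ≡ f → Side e f Y y ≡ true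
  side-intro Y {y} Yy ey = ∧-intro Yy (isYes-intro (e y ≟ f) ey)

  side-mono : ∀ {Y Y'} → Y ⊆ Y' → Side e f Y ⊆ Side e f Y'
  side-mono {Y} {Y'} Y⊆Y' y s with side-elim Y s
  ... | Yy , ey = side-intro Y' (Y⊆Y' y Yy) ey

module _ {n m : ℕ} (e : Fin m → Fin n) (r : Fin m → ℕ) (f : Fin n) where

  pref-elim : ∀ Y x {y} → Pref e r f Y x y ≡ true → Side e f Y y ≡ true × (r y <ᵇ r x) ≡ true
  pref-elim Y x {y} = ∧-elim {Side e f Y y}

  pref-mono : ∀ {Y Y'} x → Y ⊆ Y' → Pref e r f Y x ⊆ Pref e r f Y' x
  pref-mono {Y} x Y⊆Y' y p with pref-elim Y x p
  ... | s , y<x = ∧-intro (side-mono e f Y⊆Y' y s) y<x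

  pref⊆side : ∀ Y x → Pref e r f Y x ⊆ Side e f Y
  pref⊆side Y x y p = proj₁ (pref-elim Y x p)

  -- x lies on its own side but is not ranked before itself.
  pref-below-side : ∀ Y {x} → Y x ≡ true → e x ≡ f → count (Pref e r f Y x) < count (Side e f Y)
  pref-below-side Y {x} Yx ex =
    count-strict _ _ (pref⊆side Y x) x (side-intro e f Y Yx ex)
      (trans (cong (Side e f Y x ∧_) (<ᵇ-irrefl (r x))) (∧-zeroʳ _))

∪-introˡ : ∀ {m} {A B : Outcome m} → A ⊆ (A ∪ B)
∪-introˡ _ = ∨-introˡ

∪-monoʳ : ∀ {m} {A B Z : Outcome m} → B ⊆ Z → (A ∪ B) ⊆ (A ∪ Z)
∪-monoʳ B⊆Z y AB with ∨-elim AB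
... | inj₁ Ay = ∨-introˡ Ay
... | inj₂ By = ∨-introʳ (B⊆Z y By)

module _ {n m : ℕ} (own other : Fin m → Fin n) (r : Fin m → ℕ) (f : Fin n)
         {A B : Outcome m} {x : Fin m} where
  open ≤-Reasoning

  flow-through-bound : ∀ {y} →
    (∀ z → B z ≡ true → own z ≡ f → z ≡ x) →
    count (Side own f A) ≤ count (Side other f A) →
    B y ≡ true → A y ≡ false → other y ≡ f →
    count (Pref own r f (A ∪ B) x) < count (Side other f (A ∪ B))
  flow-through-bound {y} only-x balanced By ¬Ay oy = begin-strict
    count (Pref own r f (A ∪ B) x) ≤⟨ count-mono _ _ competitors-in-A ⟩
    count (Pref own r f A x)       ≤⟨ count-mono _ _ (pref⊆side own r f A x) ⟩
    count (Side own f A)           ≤⟨ balanced ⟩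
    count (Side other f A)         <⟨ count-strict _ _ (side-mono other f ∪-introˡ) y y-added y-not-in-A ⟩
    count (Side other f (A ∪ B))   ∎
    where
    y-added : Side other f (A ∪ B) y ≡ true
    y-added = side-intro other f (A ∪ B) (∨-introʳ By) oy
    y-not-in-A : Side other f A y ≡ false
    y-not-in-A = cong (_∧ _) ¬Ay

    -- the only contract of B on x's side of f is x itself, which does not compete with x
    competitors-in-A : Pref own r f (A ∪ B) x ⊆ Pref own r f A x
    competitors-in-A z p with pref-elim own r f (A ∪ B) x p
    ... | s , z<x with side-elim own f (A ∪ B) s
    ... | AzBz , oz with ∨-elim AzBz
    ... | inj₁ Az = ∧-intro (side-intro own f A Az oz) z<x
    ... | inj₂ Bz with only-x z Bz oz
    ... | refl = ⊥-elim (true≢false (trans (sym z<x) (<ᵇ-irrefl (r z))))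

  entry-bound : ∀ {Z} → B ⊆ Z → (∀ z → Z z ≡ true → other z ≢ f) →
    count (Pref own r f (A ∪ Z) x) < count (Side other f (A ∪ Z)) →
    count (Pref own r f (A ∪ B) x) < count (Side other f (A ∪ B))
  entry-bound {Z} B⊆Z untouched accepted = begin-strict
    count (Pref own r f (A ∪ B) x) ≤⟨ count-mono _ _ (pref-mono own r f x (∪-monoʳ B⊆Z)) ⟩
    count (Pref own r f (A ∪ Z) x) <⟨ accepted ⟩
    count (Side other f (A ∪ Z))   ≤⟨ count-mono _ _ other-side-in-A ⟩
    count (Side other f A)         ≤⟨ count-mono _ _ (side-mono other f ∪-introˡ) ⟩
    count (Side other f (A ∪ B))   ∎
    where
    other-side-in-A : Side other f (A ∪ Z) ⊆ Side other f A
    other-side-in-A z s with side-elim other f (A ∪ Z) s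
    ... | AzZz , oz with ∨-elim AzZz
    ... | inj₁ Az = side-intro other f A Az oz
    ... | inj₂ Zz = ⊥-elim (untouched z Zz oz)

module _ {n m : ℕ} (N : FlowNetwork n m) where
  open FlowNetwork N

  terminal? : ∀ f → Dec (Terminal f)
  terminal? f = all? (λ x → ¬? (buyer x ≟ f)) ⊎-dec all? (λ x → ¬? (seller x ≟ f))

  chosen-topK : ∀ {f Y x} → InC f Y x → ¬ Terminal f → TopK f Y x
  chosen-topK (_ , inj₁ t)         nt = ⊥-elim (nt t)
  chosen-topK (_ , inj₂ (_ , top)) _  = top

  chosen-downstream : ∀ {f Y x} → InC f Y x → ¬ Terminal f → seller x ≡ f →
    count (Pref seller (rankS f) f Y x) < count (Side buyer f Y)
  chosen-downstream chosen nt sx = <-≤-trans (proj₂ (chosen-topK chosen nt) sx) (m⊓n≤m _ _)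

  chosen-upstream : ∀ {f Y x} → InC f Y x → ¬ Terminal f → buyer x ≡ f →
    count (Pref buyer (rankB f) f Y x) < count (Side seller f Y)
  chosen-upstream chosen nt bx = <-≤-trans (proj₁ (chosen-topK chosen nt) bx) (m⊓n≤n _ _)

  -- An acceptable outcome is balanced at every non-terminal agent: since every chosen
  -- contract beats the other side's count, so does the size of each side.
  module _ {A : Outcome m} (acc : Acceptable A) {f : Fin n} (nt : ¬ Terminal f) where

    balanced-downstream : count (Side seller f A) ≤ count (Side buyer f A)
    balanced-downstream = count-≤-by-rank (Side seller f A) (rankS f) _
      (λ a b sa sb → rankS-inj f a b (proj₂ (side-elim seller f A sa))
                                     (proj₂ (side-elim seller f A sb)))
      λ a sa → let (Aa , sa≡f) = side-elim seller f A sa in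
               chosen-downstream (proj₂ (acc f a) (Aa , inj₁ sa≡f)) nt sa≡f

    balanced-upstream : count (Side buyer f A) ≤ count (Side seller f A)
    balanced-upstream = count-≤-by-rank (Side buyer f A) (rankB f) _
      (λ a b ba bb → rankB-inj f a b (proj₂ (side-elim buyer f A ba))
                                     (proj₂ (side-elim buyer f A bb)))
      λ a ba → let (Aa , ba≡f) = side-elim buyer f A ba in
               chosen-upstream (proj₂ (acc f a) (Aa , inj₂ ba≡f)) nt ba≡f

  -- The contracts are edges of a directed graph on the agents from end s to end
  -- b: the network orientation is s = seller, b = buyer, and walking downstream uses the
  -- reverse one.  x ∷ xs is a chain when consecutive contracts meet: b xᵢ ≡ s xᵢ₊₁.
  Chain : (s b : Fin m → Fin n) → Fin m → List (Fin m) → Set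
  Chain s b x []       = ⊤
  Chain s b x (y ∷ ys) = b x ≡ s y × Chain s b y ys

  last∈ : ∀ x xs → last x xs ∈ x ∷ xs
  last∈ x []       = here refl
  last∈ x (y ∷ ys) = there (last∈ y ys)

  module Chains (s b : Fin m → Fin n) where

    vertices : Fin m → List (Fin m) → List (Fin n)
    vertices x xs = map s (x ∷ xs) ++ [ b (last x xs) ]

    targets : ∀ x xs → Chain s b x xs → map b (x ∷ xs) ≡ map s xs ++ [ b (last x xs) ]
    targets x []       _           = refl
    targets x (y ∷ ys) (bx≡sy , c) = cong₂ _∷_ bx≡sy (targets y ys c)

    predecessor : ∀ x xs → Chain s b x xs → ∀ {z} → z ∈ x ∷ xs →
      z ≡ x ⊎ Σ (Fin m) λ y → y ∈ x ∷ xs × b y ≡ s z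
    predecessor x xs       _           (here z≡x) = inj₁ z≡x
    predecessor x (y ∷ ys) (bx≡sy , c) (there z∈) with predecessor y ys c z∈
    ... | inj₁ refl             = inj₂ (x , here refl , bx≡sy)
    ... | inj₂ (w , w∈ , bw≡sz) = inj₂ (w , there w∈ , bw≡sz)

    successor : ∀ x xs → Chain s b x xs → ∀ {z} → z ∈ x ∷ xs →
      z ≡ last x xs ⊎ Σ (Fin m) λ y → y ∈ x ∷ xs × s y ≡ b z
    successor x []       _           (here z≡x)  = inj₁ z≡x
    successor x (y ∷ ys) (bx≡sy , _) (here refl) = inj₂ (y , there (here refl) , sym bx≡sy)
    successor x (y ∷ ys) (_ , c)     (there z∈) with successor y ys c z∈
    ... | inj₁ z≡last           = inj₁ z≡last
    ... | inj₂ (w , w∈ , sw≡bz) = inj₂ (w , there w∈ , sw≡bz)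

    record Cycle (Use : Fin m → Set) : Set where
      field
        start    : Fin m
        rest     : List (Fin m)
        chain    : Chain s b start rest
        use      : All Use (start ∷ rest)
        distinct : Unique (map s (start ∷ rest))
        closed   : b (last start rest) ≡ s start

    -- The targets of a cycle are a rotation of its sources, hence distinct as well.
    cycle-targets-distinct : ∀ {Use} (C : Cycle Use) →
      Unique (map b (Cycle.start C ∷ Cycle.rest C))
    cycle-targets-distinct C = unique-permute rotation distinct
      where
      open Cycle C
      rotation : map s (start ∷ rest) ↭ map b (start ∷ rest)
      rotation = subst (map s (start ∷ rest) ↭_)
        (sym (trans (targets start rest chain) (cong (λ v → map s rest ++ [ v ]) closed)))
        (∷↭∷ʳ (s start) (map s rest))

  chain-∷ʳ : ∀ s b x xs z → Chain s b x xs → b (last x xs) ≡ s z → Chain s b x (xs ∷ʳ z)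
  chain-∷ʳ s b x []       z _           bx≡sz = bx≡sz , tt
  chain-∷ʳ s b x (y ∷ ys) z (bx≡sy , c) e     = bx≡sy , chain-∷ʳ s b y ys z c e

  last-∷ʳ : ∀ x xs z → last x (xs ∷ʳ z) ≡ z
  last-∷ʳ x []       z = refl
  last-∷ʳ x (y ∷ ys) z = last-∷ʳ y ys z

  reverse-chain : ∀ s b x xs → Chain s b x xs → Σ (Fin m) λ y → Σ (List (Fin m)) λ ys →
    reverse (x ∷ xs) ≡ y ∷ ys × y ≡ last x xs × last y ys ≡ x × Chain b s y ys
  reverse-chain s b x []        _            = x , [] , refl , refl , refl , tt
  reverse-chain s b x (x' ∷ xs) (bx≡sx' , c) with reverse-chain s b x' xs c
  ... | y , ys , rev , y≡last , last≡x' , c' =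
    y , ys ∷ʳ x , trans (unfold-reverse x (x' ∷ xs)) (cong (_∷ʳ x) rev) , y≡last ,
    last-∷ʳ y ys x , chain-∷ʳ b s y ys x c' (trans (cong s last≡x') (sym bx≡sx'))

  reverse-cycle : ∀ {s b Use} → Chains.Cycle s b Use → Chains.Cycle b s Use
  reverse-cycle {s} {b} C with reverse-chain s b start rest chain
    where
    open Chains s b
    open Cycle C
  ... | y , ys , rev , refl , last≡x , c' = record
    { start    = y
    ; rest     = ys
    ; chain    = c'
    ; use      = All-resp-↭ (↭-sym perm) use
    ; distinct = unique-permute (map⁺ b (↭-sym perm)) (cycle-targets-distinct C)
    ; closed   = trans (cong s last≡x) (sym closed)
    }
    where
    open Chains s b
    open Cycle C
    perm : y ∷ ys ↭ start ∷ rest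
    perm = subst (_↭ start ∷ rest) rev (↭-reverse (start ∷ rest))

  -- Extend a chain of usable contracts at its start, as long as its first
  -- source is not a stopping agent.  Since a chain with distinct vertices has at most
  -- n of them, this ends either at a stopping agent or by closing a cycle.
  module Walk (s b : Fin m → Fin n) (Use : Fin m → Set) (Stop : Fin n → Set)
              (step : ∀ v → Stop v ⊎ Σ (Fin m) λ y → Use y × b y ≡ v) where
    open Chains s b
    open import Data.List.Membership.DecPropositional (_≟_ {n}) using (_∈?_)

    record Path (end : Fin m) : Set where
      field
        start    : Fin m
        rest     : List (Fin m)
        chain    : Chain s b start rest
        use      : All Use (start ∷ rest)
        distinct : Unique (vertices start rest)
        stops    : Stop (s start)
        ends     : last start rest ≡ end

    cut : ∀ {v} y x xs → b y ≡ s x → Chain s b x xs → All Use (x ∷ xs) → v ∈ vertices x xs →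
      Σ (List (Fin m)) λ p → Σ (List (Fin n)) λ later →
      Chain s b y p × All Use p × b (last y p) ≡ v × vertices x xs ≡ map s p ++ v ∷ later
    cut y x xs        by≡sx _ _ (here refl) = [] , _ , tt , [] , by≡sx , refl
    cut y x []        by≡sx _ (ux ∷ []) (there (here refl)) =
      x ∷ [] , [] , (by≡sx , tt) , ux ∷ [] , refl , refl
    cut y x (x' ∷ xs) by≡sx (bx≡sx' , c) (ux ∷ us) (there v∈) with cut x x' xs bx≡sx' c us v∈
    ... | p , later , c' , us' , ends-at-v , split =
      x ∷ p , later , (by≡sx , c') , ux ∷ us' , ends-at-v , cong (s x ∷_) split

    -- Each step stops, closes a cycle, or prepends a contract with a fresh source; the
    -- fuel exceeds the number of agents still unvisited, so it never runs out.
    extend : (fuel : ℕ) → ∀ x xs → n < length (vertices x xs) + fuel →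
      Chain s b x xs → All Use (x ∷ xs) → Unique (vertices x xs) → Path (last x xs) ⊎ Cycle Use
    extend zero x xs room _ _ distinct =
      ⊥-elim (<⇒≱ (subst (n <_) (+-identityʳ _) room) (unique-length≤ _ distinct))
    extend (suc fuel) x xs room c us distinct with step (s x)
    ... | inj₁ stop = inj₁ (record
      { start = x ; rest = xs ; chain = c ; use = us ; distinct = distinct ; stops = stop ; ends = refl })
    ... | inj₂ (y , uy , by≡sx) with s y ∈? vertices x xs
    ...   | no sy∉ = extend fuel y (x ∷ xs) (subst (n <_) (+-suc _ fuel) room) (by≡sx , c) (uy ∷ us)
                       (All.¬Any⇒All¬ _ sy∉ ∷ distinct)
    ...   | yes sy∈ with cut y x xs by≡sx c us sy∈
    ...     | p , later , c' , us' , closes , split = inj₂ (record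
      { start    = y
      ; rest     = p
      ; chain    = c'
      ; use      = uy ∷ us'
      ; distinct = unique-shift (map s p) (subst Unique split distinct)
      ; closed   = closes
      })

    walk : ∀ x → Use x → s x ≢ b x → Path x ⊎ Cycle Use
    walk x ux loop-free = extend n x [] (s≤s (n≤1+n n)) tt (ux ∷ []) ((loop-free ∷ []) ∷ [] ∷ [])

  path-or-cycle-nonempty : ∀ {B} → IsPath B ⊎ IsCycle B → ∃ λ x → B x ≡ true
  path-or-cycle-nonempty (inj₁ (x , _ , enumerates , _)) = x , proj₂ (enumerates x) (here refl)
  path-or-cycle-nonempty (inj₂ (x , _ , enumerates , _)) = x , proj₂ (enumerates x) (here refl)

  toLinked : ∀ x xs → Chain seller buyer x xs → Linked (x ∷ xs)
  toLinked x []       _       = tt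
  toLinked x (y ∷ ys) (e , c) = e , toLinked y ys c

  module Blocking (A : Outcome m) (acc : Acceptable A) (Z : Outcome m) (Z-blocks : Blocks A Z) where

    InZ : Fin m → Set
    InZ x = Z x ≡ true

    Z-chosen : ∀ {f x} → InZ x → seller x ≡ f ⊎ buyer x ≡ f → InC f (A ∪ Z) x
    Z-chosen {f} {x} Zx end = proj₂ Z-blocks f (x , Zx , end) x (Zx , end)

    Untouched : (Fin m → Fin n) → Fin n → Set
    Untouched e v = ∀ y → InZ y → e y ≢ v

    Reached : Outcome m → (Fin m → Fin n) → Fin n → Set
    Reached B e v = (Σ (Fin m) λ y → B y ≡ true × e y ≡ v) ⊎ Untouched e v

    record Trail (B : Outcome m) : Set where
      field
        inside           : B ⊆ Z
        sellers-distinct : ∀ x y → B x ≡ true → B y ≡ true → seller x ≡ seller y → x ≡ y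
        buyers-distinct  : ∀ x y → B x ≡ true → B y ≡ true → buyer x ≡ buyer y → x ≡ y
        entered          : ∀ x → B x ≡ true → Reached B buyer (seller x)
        left             : ∀ x → B x ≡ true → Reached B seller (buyer x)

    trail-blocks : ∀ {B} → Trail B → Blocks A B
    trail-blocks {B} T = disjoint , λ f _ x (Bx , end) → (∨-introʳ Bx , end) , chooses f x Bx
      where
      open Trail T

      disjoint : Disjoint B A
      disjoint x Bx Ax = proj₁ Z-blocks x (inside x Bx) Ax

      outside-A : ∀ y → B y ≡ true → A y ≡ false
      outside-A y By with A y in Ay
      ... | true  = ⊥-elim (disjoint y By Ay)
      ... | false = refl

      other-side-bound : ∀ (own other : Fin m → Fin n) r {f x} →
        (∀ z → B z ≡ true → own z ≡ f → z ≡ x) →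
        count (Side own f A) ≤ count (Side other f A) →
        count (Pref own r f (A ∪ Z) x) < count (Side other f (A ∪ Z)) →
        Reached B other f →
        count (Pref own r f (A ∪ B) x) < count (Side other f (A ∪ B))
      other-side-bound own other r only-x balanced _ (inj₁ (y , By , oy)) =
        flow-through-bound own other r _ only-x balanced By (outside-A y By) oy
      other-side-bound own other r _ _ accepted (inj₂ untouched) =
        entry-bound own other r _ inside untouched accepted

      chooses : ∀ f x → B x ≡ true → Terminal f ⊎ (¬ Terminal f × TopK f (A ∪ B) x)
      chooses f x Bx with terminal? f
      ... | yes t  = inj₁ t
      ... | no  nt = inj₂ (nt , upstream , downstream)
        where
        upstream : buyer x ≡ f → count (Pref buyer (rankB f) f (A ∪ B) x) < kf f (A ∪ B)
        upstream bx = ⊓-glb (pref-below-side buyer (rankB f) f (A ∪ B) (∨-introʳ Bx) bx)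
          (other-side-bound buyer seller (rankB f)
            (λ z Bz bz → buyers-distinct z x Bz Bx (trans bz (sym bx)))
            (balanced-upstream acc nt)
            (chosen-upstream (Z-chosen (inside x Bx) (inj₂ bx)) nt bx)
            (subst (Reached B seller) bx (left x Bx)))
        downstream : seller x ≡ f → count (Pref seller (rankS f) f (A ∪ B) x) < kf f (A ∪ B)
        downstream sx = ⊓-glb
          (other-side-bound seller buyer (rankS f)
            (λ z Bz sz → sellers-distinct z x Bz Bx (trans sz (sym sx)))
            (balanced-downstream acc nt)
            (chosen-downstream (Z-chosen (inside x Bx) (inj₁ sx)) nt sx)
            (subst (Reached B buyer) sx (entered x Bx)))
          (pref-below-side seller (rankS f) f (A ∪ B) (∨-introʳ Bx) sx)

    open import Data.List.Membership.DecPropositional (_≟_ {m}) using (_∈?_)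

    members : List (Fin m) → Outcome m
    members L x = ⌊ x ∈? L ⌋

    members-enumerate : ∀ L → Enumerates (members L) L
    members-enumerate L x = isYes-elim (x ∈? L) , isYes-intro (x ∈? L)

    open Chains seller buyer

    chain-trail : ∀ x xs → Chain seller buyer x xs → All InZ (x ∷ xs) →
      Unique (map seller (x ∷ xs)) → Unique (map buyer (x ∷ xs)) →
      Reached (members (x ∷ xs)) buyer (seller x) →
      Reached (members (x ∷ xs)) seller (buyer (last x xs)) →
      Trail (members (x ∷ xs))
    chain-trail x xs c inZ sellers buyers first-entered last-left = record
      { inside           = λ z z∈ → All.lookup inZ (listed z∈)
      ; sellers-distinct = λ _ _ z∈ z'∈ → unique-map-injective seller sellers (listed z∈) (listed z'∈)
      ; buyers-distinct  = λ _ _ z∈ z'∈ → unique-map-injective buyer buyers (listed z∈) (listed z'∈)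
      ; entered          = λ z z∈ → entered-via (predecessor x xs c (listed z∈))
      ; left             = λ z z∈ → left-via (successor x xs c (listed z∈))
      }
      where
      L = x ∷ xs

      listed : ∀ {z} → members L z ≡ true → z ∈ L
      listed {z} = isYes-elim (z ∈? L)

      entered-via : ∀ {z} → z ≡ x ⊎ (Σ (Fin m) λ y → y ∈ L × buyer y ≡ seller z) →
        Reached (members L) buyer (seller z)
      entered-via (inj₁ refl)              = first-entered
      entered-via (inj₂ (y , y∈ , by≡sz)) = inj₁ (y , isYes-intro (y ∈? L) y∈ , by≡sz)

      left-via : ∀ {z} → z ≡ last x xs ⊎ (Σ (Fin m) λ y → y ∈ L × seller y ≡ buyer z) →
        Reached (members L) seller (buyer z)
      left-via (inj₁ refl)              = last-left
      left-via (inj₂ (y , y∈ , sy≡bz)) = inj₁ (y , isYes-intro (y ∈? L) y∈ , sy≡bz)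

    BlockingPathOrCycle : Set
    BlockingPathOrCycle = Σ (Outcome m) λ B → (IsPath B ⊎ IsCycle B) × Blocks A B

    -- Cycles in Z are trails, hence block A.
    cycle-blocks : Cycle InZ → BlockingPathOrCycle
    cycle-blocks C =
      members L ,
      inj₂ (start , rest , members-enumerate L , toLinked start rest chain , distinct , closed) ,
      trail-blocks (chain-trail start rest chain use distinct (cycle-targets-distinct C)
        (inj₁ (last start rest , isYes-intro (_ ∈? L) (last∈ start rest) , closed))
        (inj₁ (start , isYes-intro (start ∈? L) (here refl) , sym closed)))
      where
      open Cycle C
      L = start ∷ rest

    next : ∀ (e : Fin m → Fin n) v → Untouched e v ⊎ Σ (Fin m) λ y → InZ y × e y ≡ v
    next e v with any? (λ y → (Z y Bool.≟ true) ×-dec (e y ≟ v))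
    ... | yes (y , Zy , ey) = inj₂ (y , Zy , ey)
    ... | no  none          = inj₁ λ y Zy ey → none (y , Zy , ey)

    module Upstream   = Walk seller buyer InZ (Untouched buyer) (next buyer)
    module Downstream = Walk buyer seller InZ (Untouched seller) (next seller)

    -- A path in Z from an agent not entered by Z to one not left by Z is a trail.
    path-blocks : ∀ {x} → Upstream.Path x → Untouched seller (buyer x) → BlockingPathOrCycle
    path-blocks P exit =
      members L , inj₁ (start , rest , members-enumerate L , toLinked start rest chain , distinct) ,
      trail-blocks (chain-trail start rest chain use (unique-prefix (map seller L) distinct) buyers
        (inj₂ stops) (inj₂ (subst (Untouched seller ∘ buyer) (sym ends) exit)))
      where
      open Upstream.Path P
      L = start ∷ rest

      -- the buyers are the vertices after the first
      buyers : Unique (map buyer L)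
      buyers with distinct
      ... | _ ∷ later-distinct = subst Unique (sym (targets start rest chain)) later-distinct

    from-exit : ∀ x → InZ x → Untouched seller (buyer x) → BlockingPathOrCycle
    from-exit x Zx exit with Upstream.walk x Zx (seller≢buyer x)
    ... | inj₁ P = path-blocks P exit
    ... | inj₂ C = cycle-blocks C

    blocking-path-or-cycle : ∀ z → InZ z → BlockingPathOrCycle
    blocking-path-or-cycle z Zz with Downstream.walk z Zz (seller≢buyer z ∘ sym)
    ... | inj₁ P = from-exit start (All.head use) stops
      where open Downstream.Path P
    ... | inj₂ C = cycle-blocks (reverse-cycle C)

theorem3 : ∀ (n m : ℕ) (N : FlowNetwork n m) (A : Outcome m) →
           FlowNetwork.PathOrCycleStable N A ⇔ FlowNetwork.Stable N A
theorem3 n m N A = mk⇔ to from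
  where
  open FlowNetwork N

  -- A non-empty blocking set contains a blocking path or cycle.
  to : PathOrCycleStable A → Stable A
  to (acc , no-blocking-path-or-cycle) = acc , λ Z (z , Zz) Z-blocks →
    let (B , path-or-cycle , B-blocks) = Blocking.blocking-path-or-cycle N A acc Z Z-blocks z Zz
    in  no-blocking-path-or-cycle B path-or-cycle B-blocks

  -- Paths and cycles are non-empty sets of contracts.
  from : Stable A → PathOrCycleStable A
  from (acc , no-blocking-set) = acc , λ B path-or-cycle →
    no-blocking-set B (path-or-cycle-nonempty N path-or-cycle)
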